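{- Let $G$ be a coloured caterpillar (a $1$-caterpillar or a cyclic $1$-caterpillar) with backbone $B$ and with colourful stars, such that at least two distinct colours each appear on at least two vertices of $G$. Then there exists an optimal solution $S$ to Colourful Components on $G$ (i.e. a minimum-size set of edges whose removal makes $G$ colourful) with $S\subseteq B$, where $B$ is regarded as its set of edges.
   Context: A coloured graph is a graph $G=(V,E)$ with a (not necessarily proper) vertex colouring $c$. A connected component is colourful if its vertices have pairwise different colours; a graph is colourful if all its components are. A $1$-caterpillar is a tree with a fixed path (the backbone) such that every vertex is on the backbone or adjacent to a backbone vertex. A cyclic $1$-caterpillar is a connected graph with a unique cycle (the backbone) such that every vertex either lies on the backbone or has degree $1$ with its unique neighbour on the backbone. For a backbone vertex $v$, the star of $v$ consists of $v$ together with its neighbours not on the backbone; $G$ has colourful stars if every star contains vertices of pairwise distinct colours. -}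

module Defs where

open import Data.Nat using (ℕ; zero; suc; _+_; _≤_)
open import Data.Fin using (Fin; zero; suc; inject₁; splitAt; _↑ʳ_)
open import Data.Fin.Subset using (Subset; _∈_; _∉_; ∣_∣)
open import Data.Sum using (_⊎_; inj₁; inj₂; [_,_])
open import Data.Product using (_×_; _,_; Σ; ∃; ∃-syntax)
open import Relation.Binary.PropositionalEquality using (_≡_; _≢_)

-- General finite (multi)graphs: an arbitrary vertex type and m edges,
-- each edge given by its pair of endpoints (undirected).

record Graph : Set₁ where
  field
    V    : Set
    m    : ℕ
    ends : Fin m → V × V
open Graph public

EdgeSet : Graph → Set
EdgeSet G = Subset (m G)

Adj : (G : Graph) → EdgeSet G → V G → V G → Set
Adj G S u v = ∃[ e ] (e ∉ S × (ends G e ≡ (u , v) ⊎ ends G e ≡ (v , u)))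

data Reach (G : Graph) (S : EdgeSet G) : V G → V G → Set where
  here : ∀ {u} → Reach G S u u
  step : ∀ {u v w} → Adj G S u v → Reach G S v w → Reach G S u w

Colourful : (G : Graph) → (V G → ℕ) → EdgeSet G → Set
Colourful G c S = ∀ u v → Reach G S u v → c u ≡ c v → u ≡ v

OptimalSolution : (G : Graph) → (V G → ℕ) → EdgeSet G → Set
OptimalSolution G c S =
  Colourful G c S × (∀ S′ → Colourful G c S′ → ∣ S ∣ ≤ ∣ S′ ∣)

-- Caterpillars.  A caterpillar is given by its backbone vertices
-- (Fin nb), its non-backbone vertices (Fin l) and, for each
-- non-backbone vertex, the backbone vertex it is attached to.

data Kind : Set where
  path cyclic : Kind

bbVerts : Kind → ℕ → ℕ
bbVerts path   k = suc k
bbVerts cyclic k = suc (suc (suc k))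

bbEdges : Kind → ℕ → ℕ
bbEdges path   k = k
bbEdges cyclic k = suc (suc (suc k))

-- cyclic successor on Fin (suc n): i ↦ i+1 mod (n+1)
next : ∀ {n} → Fin (suc n) → Fin (suc n)
next {zero}  zero    = zero
next {suc n} zero    = suc zero
next {suc n} (suc i) with next {n} i
... | zero  = zero
... | suc j = suc (suc j)

CatV : Kind → ℕ → ℕ → Set
CatV κ k l = Fin (bbVerts κ k) ⊎ Fin l

bbEnds : ∀ κ k l → Fin (bbEdges κ k) → CatV κ k l × CatV κ k l
bbEnds path   k l i = inj₁ (inject₁ i) , inj₁ (suc i)
bbEnds cyclic k l i = inj₁ i , inj₁ (next i)

-- The caterpillar graph: edges are the backbone edges (the
-- first bbEdges κ k indices) followed by one pendant edge per
-- non-backbone vertex.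
Cat : (κ : Kind) (k l : ℕ) → (Fin l → Fin (bbVerts κ k)) → Graph
Cat κ k l att = record
  { V    = CatV κ k l
  ; m    = bbEdges κ k + l
  ; ends = λ e → [ bbEnds κ k l , (λ j → inj₁ (att j) , inj₂ j) ] (splitAt (bbEdges κ k) e)
  }

InBackbone : (κ : Kind) (k l : ℕ) (att : Fin l → Fin (bbVerts κ k)) →
             EdgeSet (Cat κ k l att) → Set
InBackbone κ k l att S = ∀ (j : Fin l) → (bbEdges κ k ↑ʳ j) ∉ S

-- colourful stars: every star (backbone vertex with its pendant
-- neighbours) has pairwise distinct colours
ColourfulStars : (κ : Kind) (k l : ℕ) (att : Fin l → Fin (bbVerts κ k)) →
                 (CatV κ k l → ℕ) → Set
ColourfulStars κ k l att c =
  (∀ j → c (inj₁ (att j)) ≢ c (inj₂ j)) ×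
  (∀ j j′ → att j ≡ att j′ → c (inj₂ j) ≡ c (inj₂ j′) → j ≡ j′)

TwoRepeatedColours : {X : Set} → (X → ℕ) → Set
TwoRepeatedColours {X} c =
  ∃[ a ] ∃[ b ] (a ≢ b ×
    (∃[ u ] ∃[ v ] (u ≢ v × c u ≡ a × c v ≡ a)) ×
    (∃[ u ] ∃[ v ] (u ≢ v × c u ≡ b × c v ≡ b)))

module Submission where

-- Start from any optimal solution S and remove its pendant cuts one leaf
-- at a time by an exchange: a colourful solution S′ with ∣ S′ ∣ ≤ ∣ S ∣
-- that no longer cuts the pendant edge of the leaf j and cuts no new
-- pendant edge.
-- Reattaching j only endangers colourfulness through a vertex t of the
-- colour of j in the component of its attachment vertex; by colourful
-- stars t sits at another backbone position, so backbone cuts between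
-- the two positions repair it.  On a path one cut suffices (and replaces
-- the pendant cut).  On a cycle two cuts are needed: if S cuts the
-- backbone already, one more cut does; otherwise the whole backbone is
-- connected in G − S, so each repeated colour lies on a cut leaf, and one
-- of another colour than j is freed too, paying for the second cut.

open import Defs
open import Data.Nat using (ℕ; zero; suc; _+_; _≤_; _<_; _<ᵇ_; z≤n; s≤s; _≟_; _≤?_)
open import Data.Nat.Properties
  using (≤-refl; ≤-trans; ≤-reflexive; <⇒≤; <⇒≢; ≤∧≢⇒<; ≰⇒>; <-cmp; n≤1+n; +-suc; +-monoʳ-≤; module ≤-Reasoning)
open import Data.Bool using (Bool; true; false; _xor_)
open import Data.Bool.Properties using (xor-∧-commutativeRing)
open import Data.Fin using (Fin; zero; suc; toℕ; fromℕ<; inject₁; splitAt; _↑ˡ_; _↑ʳ_)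
  renaming (_≟_ to _≟ᶠ_)
open import Data.Fin.Properties
  using (toℕ-injective; toℕ-fromℕ<; toℕ-inject₁; toℕ<n; toℕ≤pred[n]; all?; any?;
         splitAt-↑ˡ; splitAt-↑ʳ; splitAt⁻¹-↑ˡ; splitAt⁻¹-↑ʳ)
open import Data.Fin.Induction using (<-weakInduction)
open import Data.Fin.Subset using (Subset; _∈_; _∉_; _⊆_; ∣_∣; _∪_; _─_; ⁅_⁆; ⊤; inside; outside)
  renaming (⊥ to ∅)
open import Data.Fin.Subset.Properties
  using (_∈?_; anySubset?; ∈⊤; ∉⊥; drop-∷-⊆; p⊆p∪q; q⊆p∪q; x∈p∪q⁻; ∣p∣≤∣p∪q∣; ∣q∣≤∣p∪q∣; p─q⊆p;
         x∈p∧x∉q⇒x∈p─q; x∈⁅x⁆; x∈⁅y⁆⇒x≡y; ∣⁅x⁆∣≡1; ∣⊥∣≡0)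
open import Data.Vec using ([]; _∷_; here; there)
open import Data.List using (List; []; _∷_; filter; allFin)
open import Data.List.Membership.Propositional using () renaming (_∈_ to _∈ˡ_)
open import Data.List.Membership.Propositional.Properties using (∈-filter⁺; ∈-filter⁻; ∈-allFin)
open import Data.List.Relation.Unary.Any using (here; there)
open import Data.List.Relation.Unary.Any.Properties using (¬Any[])
open import Data.Sum using (_⊎_; inj₁; inj₂) renaming (map to map-⊎)
open import Data.Sum.Properties using (≡-dec)
open import Data.Product using (_×_; _,_; ∃; ∃-syntax; proj₁; proj₂)
open import Data.Empty using (⊥-elim)
open import Function using (_∘_)
open import Relation.Binary.Definitions using (DecidableEquality; tri<; tri≈; tri>)
open import Relation.Binary.PropositionalEquality
  using (_≡_; _≢_; refl; sym; trans; cong; cong₂; subst; subst₂)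
open import Relation.Nullary using (Dec; yes; no; ¬_)
open import Relation.Nullary.Decidable using (map′; ¬?; _×-dec_; _⊎-dec_; _→-dec_)
open import Relation.Unary using (Decidable)
open import Algebra.Bundles using (CommutativeRing)
open import Algebra.Properties.CommutativeSemigroup
  (CommutativeRing.+-commutativeSemigroup xor-∧-commutativeRing) using (interchange)

module _ {G : Graph} {S : EdgeSet G} where

  adj-sym : ∀ {u v} → Adj G S u v → Adj G S v u
  adj-sym (e , e∉S , inj₁ uv) = e , e∉S , inj₂ uv
  adj-sym (e , e∉S , inj₂ vu) = e , e∉S , inj₁ vu

  reach-trans : ∀ {u v w} → Reach G S u v → Reach G S v w → Reach G S u w
  reach-trans here         q = q
  reach-trans (step uv  p) q = step uv (reach-trans p q)

  reach-sym : ∀ {u v} → Reach G S u v → Reach G S v u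
  reach-sym here        = here
  reach-sym (step uv p) = reach-trans (reach-sym p) (step (adj-sym uv) here)

-- We decide
-- reachability using only the edges of a list L, by induction on L: a
-- walk along e ∷ L shortens to one that avoids e or runs x ⇝ a, e, b ⇝ y
-- (or x ⇝ b, e, a ⇝ y) inside L, where a, b are the ends of e.

module DecidableReach (G : Graph) (_≟ᵛ_ : DecidableEquality (V G)) where

  Joins : Fin (m G) → V G → V G → Set
  Joins e u v = ends G e ≡ (u , v) ⊎ ends G e ≡ (v , u)

  data ReachVia (L : List (Fin (m G))) : V G → V G → Set where
    here : ∀ {u} → ReachVia L u u
    step : ∀ {e u v w} → e ∈ˡ L → Joins e u v → ReachVia L v w → ReachVia L u w

  via-trans : ∀ {L u v w} → ReachVia L u v → ReachVia L v w → ReachVia L u w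
  via-trans here           q = q
  via-trans (step e∈ uv p) q = step e∈ uv (via-trans p q)

  via-weaken : ∀ {e L u v} → ReachVia L u v → ReachVia (e ∷ L) u v
  via-weaken here           = here
  via-weaken (step e∈ uv p) = step (there e∈) uv (via-weaken p)

  via-nil : ∀ {u v} → ReachVia [] u v → u ≡ v
  via-nil here         = refl
  via-nil (step () _ _)

  module _ (e : Fin (m G)) (L : List (Fin (m G))) where

    private
      a b : V G
      a = proj₁ (ends G e)
      b = proj₂ (ends G e)

    ViaCons : V G → V G → Set
    ViaCons x y = ReachVia L x y ⊎ (ReachVia L x a × ReachVia L b y)
                                 ⊎ (ReachVia L x b × ReachVia L a y)

    private
      start : ∀ {x y} → x ≡ y → ReachVia L x y
      start refl = here

      enter : ∀ {x y z} → x ≡ y → ReachVia L y z → ReachVia L x z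
      enter refl p = p

    via-cons⁻ : ∀ {x y} → ReachVia (e ∷ L) x y → ViaCons x y
    via-cons⁻ here = inj₁ here
    via-cons⁻ (step (here refl) (inj₁ ab) p) with via-cons⁻ p
    ... | inj₁ q              = inj₂ (inj₁ (start (sym (cong proj₁ ab)) , enter (cong proj₂ ab) q))
    ... | inj₂ (inj₁ (_ , q)) = inj₂ (inj₁ (start (sym (cong proj₁ ab)) , q))
    ... | inj₂ (inj₂ (_ , q)) = inj₁ (enter (sym (cong proj₁ ab)) q)
    via-cons⁻ (step (here refl) (inj₂ ba) p) with via-cons⁻ p
    ... | inj₁ q              = inj₂ (inj₂ (start (sym (cong proj₂ ba)) , enter (cong proj₁ ba) q))
    ... | inj₂ (inj₁ (_ , q)) = inj₁ (enter (sym (cong proj₂ ba)) q)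
    ... | inj₂ (inj₂ (_ , q)) = inj₂ (inj₂ (start (sym (cong proj₂ ba)) , q))
    via-cons⁻ (step (there e∈) uv p) with via-cons⁻ p
    ... | inj₁ q              = inj₁ (step e∈ uv q)
    ... | inj₂ (inj₁ (q , r)) = inj₂ (inj₁ (step e∈ uv q , r))
    ... | inj₂ (inj₂ (q , r)) = inj₂ (inj₂ (step e∈ uv q , r))

    via-cons⁺ : ∀ {x y} → ViaCons x y → ReachVia (e ∷ L) x y
    via-cons⁺ (inj₁ p)              = via-weaken p
    via-cons⁺ (inj₂ (inj₁ (p , q))) = via-trans (via-weaken p) (step (here refl) (inj₁ refl) (via-weaken q))
    via-cons⁺ (inj₂ (inj₂ (p , q))) = via-trans (via-weaken p) (step (here refl) (inj₂ refl) (via-weaken q))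

  reachVia? : ∀ L x y → Dec (ReachVia L x y)
  reachVia? []      x y = map′ (λ { refl → here }) via-nil (x ≟ᵛ y)
  reachVia? (e ∷ L) x y = map′ (via-cons⁺ e L) (via-cons⁻ e L)
    (reachVia? L x y ⊎-dec ((reachVia? L x a ×-dec reachVia? L b y)
                            ⊎-dec (reachVia? L x b ×-dec reachVia? L a y)))
    where
    a b : V G
    a = proj₁ (ends G e)
    b = proj₂ (ends G e)

  module _ (S : EdgeSet G) where

    private
      outside-S : List (Fin (m G))
      outside-S = filter (λ e → ¬? (e ∈? S)) (allFin (m G))

      reach⇒via : ∀ {x y} → Reach G S x y → ReachVia outside-S x y
      reach⇒via here = here
      reach⇒via (step (e , e∉S , uv) p) =
        step (∈-filter⁺ (λ e → ¬? (e ∈? S)) (∈-allFin e) e∉S) uv (reach⇒via p)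

      via⇒reach : ∀ {x y} → ReachVia outside-S x y → Reach G S x y
      via⇒reach here = here
      via⇒reach (step e∈ uv p) =
        step (_ , proj₂ (∈-filter⁻ (λ e → ¬? (e ∈? S)) {xs = allFin (m G)} e∈) , uv) (via⇒reach p)

    reach? : ∀ x y → Dec (Reach G S x y)
    reach? x y = map′ via⇒reach reach⇒via (reachVia? outside-S x y)

minimum-subset : ∀ {n} (P : Subset n → Set) → Decidable P → ∀ s₀ → P s₀ →
                 ∃[ s ] (P s × (∀ s′ → P s′ → ∣ s ∣ ≤ ∣ s′ ∣))
minimum-subset P P? s₀ p₀ = descend ∣ s₀ ∣ (s₀ , p₀ , ≤-refl)
  where
  descend : ∀ b → ∃[ s ] (P s × ∣ s ∣ ≤ b) → ∃[ s ] (P s × (∀ s′ → P s′ → ∣ s ∣ ≤ ∣ s′ ∣))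
  descend zero    (s , ps , ∣s∣≤0) = s , ps , λ _ _ → ≤-trans ∣s∣≤0 z≤n
  descend (suc b) (s , ps , ∣s∣≤b+1) with anySubset? (λ s′ → P? s′ ×-dec (∣ s′ ∣ ≤? b))
  ... | yes smaller = descend b smaller
  ... | no  none    = s , ps , λ s′ ps′ → ≤-trans ∣s∣≤b+1 (≰⇒> (λ ∣s′∣≤b → none (s′ , ps′ , ∣s′∣≤b)))

∣p∪q∣≤∣p∣+∣q∣ : ∀ {n} (p q : Subset n) → ∣ p ∪ q ∣ ≤ ∣ p ∣ + ∣ q ∣
∣p∪q∣≤∣p∣+∣q∣ []            []            = z≤n
∣p∪q∣≤∣p∣+∣q∣ (inside ∷ p)  (inside ∷ q)  = s≤s (≤-trans (∣p∪q∣≤∣p∣+∣q∣ p q) (+-monoʳ-≤ ∣ p ∣ (n≤1+n _)))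
∣p∪q∣≤∣p∣+∣q∣ (inside ∷ p)  (outside ∷ q) = s≤s (∣p∪q∣≤∣p∣+∣q∣ p q)
∣p∪q∣≤∣p∣+∣q∣ (outside ∷ p) (inside ∷ q)  =
  ≤-trans (s≤s (∣p∪q∣≤∣p∣+∣q∣ p q)) (≤-reflexive (sym (+-suc ∣ p ∣ ∣ q ∣)))
∣p∪q∣≤∣p∣+∣q∣ (outside ∷ p) (outside ∷ q) = ∣p∪q∣≤∣p∣+∣q∣ p q

∣p─q∣+∣q∣≤∣p∣ : ∀ {n} (p q : Subset n) → q ⊆ p → ∣ p ─ q ∣ + ∣ q ∣ ≤ ∣ p ∣
∣p─q∣+∣q∣≤∣p∣ []            []            _   = z≤n
∣p─q∣+∣q∣≤∣p∣ (inside ∷ p)  (inside ∷ q)  q⊆p =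
  ≤-trans (≤-reflexive (+-suc ∣ p ─ q ∣ ∣ q ∣)) (s≤s (∣p─q∣+∣q∣≤∣p∣ p q (drop-∷-⊆ q⊆p)))
∣p─q∣+∣q∣≤∣p∣ (outside ∷ p) (inside ∷ q)  q⊆p with q⊆p here
... | ()
∣p─q∣+∣q∣≤∣p∣ (inside ∷ p)  (outside ∷ q) q⊆p = s≤s (∣p─q∣+∣q∣≤∣p∣ p q (drop-∷-⊆ q⊆p))
∣p─q∣+∣q∣≤∣p∣ (outside ∷ p) (outside ∷ q) q⊆p = ∣p─q∣+∣q∣≤∣p∣ p q (drop-∷-⊆ q⊆p)

∣replace∣≤ : ∀ {n} (s q r : Subset n) → q ⊆ s → ∣ r ∣ ≤ ∣ q ∣ → ∣ (s ─ q) ∪ r ∣ ≤ ∣ s ∣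
∣replace∣≤ s q r q⊆s ∣r∣≤∣q∣ = begin
  ∣ (s ─ q) ∪ r ∣   ≤⟨ ∣p∪q∣≤∣p∣+∣q∣ (s ─ q) r ⟩
  ∣ s ─ q ∣ + ∣ r ∣ ≤⟨ +-monoʳ-≤ ∣ s ─ q ∣ ∣r∣≤∣q∣ ⟩
  ∣ s ─ q ∣ + ∣ q ∣ ≤⟨ ∣p─q∣+∣q∣≤∣p∣ s q q⊆s ⟩
  ∣ s ∣             ∎
  where open ≤-Reasoning

∈q⇒∉p─q : ∀ {n} {p q : Subset n} {x} → x ∈ q → x ∉ p ─ q
∈q⇒∉p─q {p = _ ∷ _} {q = inside ∷ _} here ()
∈q⇒∉p─q {p = _ ∷ _} {q = _ ∷ _} (there x∈q) (there x∈p─q) =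
  ∈q⇒∉p─q x∈q x∈p─q

⁅⁆-⊆ : ∀ {n} {x : Fin n} {s} → x ∈ s → ⁅ x ⁆ ⊆ s
⁅⁆-⊆ {s = s} x∈s z∈⁅x⁆ = subst (_∈ s) (sym (x∈⁅y⁆⇒x≡y _ z∈⁅x⁆)) x∈s

∈-pair⁻ : ∀ {n} {x y z : Fin n} → z ∈ ⁅ x ⁆ ∪ ⁅ y ⁆ → z ≡ x ⊎ z ≡ y
∈-pair⁻ {x = x} {y} z∈ with x∈p∪q⁻ ⁅ x ⁆ ⁅ y ⁆ z∈
... | inj₁ z∈⁅x⁆ = inj₁ (x∈⁅y⁆⇒x≡y x z∈⁅x⁆)
... | inj₂ z∈⁅y⁆ = inj₂ (x∈⁅y⁆⇒x≡y y z∈⁅y⁆)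

pair-⊆ : ∀ {n} {x y : Fin n} {s} → x ∈ s → y ∈ s → ⁅ x ⁆ ∪ ⁅ y ⁆ ⊆ s
pair-⊆ {s = s} x∈s y∈s z∈ with ∈-pair⁻ z∈
... | inj₁ refl = x∈s
... | inj₂ refl = y∈s

∣pair∣≤2 : ∀ {n} (x y : Fin n) → ∣ ⁅ x ⁆ ∪ ⁅ y ⁆ ∣ ≤ 2
∣pair∣≤2 x y = ≤-trans (∣p∪q∣≤∣p∣+∣q∣ ⁅ x ⁆ ⁅ y ⁆)
                       (≤-reflexive (cong₂ _+_ (∣⁅x⁆∣≡1 x) (∣⁅x⁆∣≡1 y)))

2≤∣pair∣ : ∀ {n} {x y : Fin n} → x ≢ y → 2 ≤ ∣ ⁅ x ⁆ ∪ ⁅ y ⁆ ∣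
2≤∣pair∣ {x = zero}  {zero}  x≢y = ⊥-elim (x≢y refl)
2≤∣pair∣ {x = zero}  {suc y} _   = s≤s (≤-trans (≤-reflexive (sym (∣⁅x⁆∣≡1 y))) (∣q∣≤∣p∪q∣ ∅ ⁅ y ⁆))
2≤∣pair∣ {x = suc x} {zero}  _   = s≤s (≤-trans (≤-reflexive (sym (∣⁅x⁆∣≡1 x))) (∣p∣≤∣p∪q∣ ⁅ x ⁆ ∅))
2≤∣pair∣ {x = suc x} {suc y} x≢y = 2≤∣pair∣ (λ x≡y → x≢y (cong suc x≡y))

-- Backbone positions are numbers p; the cut
-- e separates position e from position e + 1.  For cuts e₁ and e₂,
-- twoCut e₁ e₂ p records the parity of the number of cuts before p:
-- it is constant along every backbone edge that is not cut, including
-- the closing edge of a cycle, and it changes across a cut pair.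

<ᵇ-true : ∀ {e p} → e < p → (e <ᵇ p) ≡ true
<ᵇ-true {zero}  {suc p} _         = refl
<ᵇ-true {suc e} {suc p} (s≤s e<p) = <ᵇ-true e<p

<ᵇ-false : ∀ {e p} → p ≤ e → (e <ᵇ p) ≡ false
<ᵇ-false {p = zero}     z≤n       = refl
<ᵇ-false {suc e} {suc p} (s≤s p≤e) = <ᵇ-false p≤e

<ᵇ-step : ∀ {e p} → p ≢ e → (e <ᵇ p) ≡ (e <ᵇ suc p)
<ᵇ-step {zero}  {zero}  p≢e = ⊥-elim (p≢e refl)
<ᵇ-step {zero}  {suc p} _   = refl
<ᵇ-step {suc e} {zero}  _   = refl
<ᵇ-step {suc e} {suc p} p≢e = <ᵇ-step (λ p≡e → p≢e (cong suc p≡e))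

twoCut : ℕ → ℕ → ℕ → Bool
twoCut e₁ e₂ p = (e₁ <ᵇ p) xor (e₂ <ᵇ p)

twoCut-step : ∀ {e₁ e₂ p} → p ≢ e₁ → p ≢ e₂ → twoCut e₁ e₂ p ≡ twoCut e₁ e₂ (suc p)
twoCut-step p≢e₁ p≢e₂ = cong₂ _xor_ (<ᵇ-step p≢e₁) (<ᵇ-step p≢e₂)

twoCut-wrap : ∀ {e₁ e₂ n} → e₁ < n → e₂ < n → twoCut e₁ e₂ n ≡ twoCut e₁ e₂ 0
twoCut-wrap e₁<n e₂<n rewrite <ᵇ-true e₁<n | <ᵇ-true e₂<n = refl

splits : ℕ → ℕ → ℕ → Bool
splits e x y = (e <ᵇ x) xor (e <ᵇ y)

data Separates (e₁ e₂ x y : ℕ) : Set where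
  separated : splits e₁ x y xor splits e₂ x y ≡ true → Separates e₁ e₂ x y

separates⇒sides-differ : ∀ {e₁ e₂ x y} → Separates e₁ e₂ x y → twoCut e₁ e₂ x ≢ twoCut e₁ e₂ y
separates⇒sides-differ {e₁} {e₂} {x} {y} (separated sep) same =
  xor-true⇒≢ (trans (interchange (e₁ <ᵇ x) (e₂ <ᵇ x) (e₁ <ᵇ y) (e₂ <ᵇ y)) sep) same
  where
  xor-true⇒≢ : ∀ {a b} → a xor b ≡ true → a ≢ b
  xor-true⇒≢ {true}  {true}  ()
  xor-true⇒≢ {false} {false} ()
  xor-true⇒≢ {true}  {false} _ ()
  xor-true⇒≢ {false} {true}  _ ()

lower-splits : ∀ {n x y} → x ≢ y → x ≤ n → y ≤ n → ∃[ e ] (e < n × splits e x y ≡ true)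
lower-splits {n} {x} {y} x≢y x≤n y≤n with <-cmp x y
... | tri< x<y _ _ = x , ≤-trans x<y y≤n , cong₂ _xor_ (<ᵇ-false {x} ≤-refl) (<ᵇ-true x<y)
... | tri≈ _ x≡y _ = ⊥-elim (x≢y x≡y)
... | tri> _ _ y<x = y , ≤-trans y<x x≤n , cong₂ _xor_ (<ᵇ-true y<x) (<ᵇ-false {y} ≤-refl)

top-splits-nothing : ∀ {n x y} → x ≤ n → y ≤ n → splits n x y ≡ false
top-splits-nothing x≤n y≤n rewrite <ᵇ-false x≤n | <ᵇ-false y≤n = refl

-- Path backbones: one new cut, paired with the inert top cut n.
path-cut : ∀ {n x y} → x ≢ y → x ≤ n → y ≤ n → ∃[ e ] (e < n × Separates e n x y)
path-cut x≢y x≤n y≤n with lower-splits x≢y x≤n y≤n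
... | e , e<n , e-splits = e , e<n , separated (cong₂ _xor_ e-splits (top-splits-nothing x≤n y≤n))

second-cut : ∀ {n x y} e₁ → x ≢ y → x ≤ n → y ≤ n → ∃[ e₂ ] (e₂ ≤ n × Separates e₁ e₂ x y)
second-cut {n} {x} {y} e₁ x≢y x≤n y≤n with splits e₁ x y in e₁-splits
... | true  = n , ≤-refl , separated (cong₂ _xor_ e₁-splits (top-splits-nothing x≤n y≤n))
... | false with lower-splits x≢y x≤n y≤n
...   | e₂ , e₂<n , e₂-splits = e₂ , <⇒≤ e₂<n , separated (cong₂ _xor_ e₁-splits e₂-splits)

-- Take the lower cuts a, b of the pairs; if one of them already splits
-- both pairs, pair it with the inert top cut, otherwise use a and b.
two-cuts : ∀ {n x₁ y₁ x₂ y₂} → x₁ ≢ y₁ → x₁ ≤ n → y₁ ≤ n → x₂ ≢ y₂ → x₂ ≤ n → y₂ ≤ n →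
           ∃[ e₁ ] ∃[ e₂ ] (e₁ ≤ n × e₂ ≤ n × Separates e₁ e₂ x₁ y₁ × Separates e₁ e₂ x₂ y₂)
two-cuts {n} {x₁} {y₁} {x₂} {y₂} x₁≢y₁ x₁≤n y₁≤n x₂≢y₂ x₂≤n y₂≤n
  with lower-splits x₁≢y₁ x₁≤n y₁≤n | lower-splits x₂≢y₂ x₂≤n y₂≤n
     | top-splits-nothing x₁≤n y₁≤n | top-splits-nothing x₂≤n y₂≤n
... | a , a<n , a-splits₁ | b , b<n , b-splits₂ | top₁ | top₂
  with splits a x₂ y₂ in a-splits₂ | splits b x₁ y₁ in b-splits₁
... | true  | _     = a , n , <⇒≤ a<n , ≤-refl ,
                      separated (cong₂ _xor_ a-splits₁ top₁) , separated (cong₂ _xor_ a-splits₂ top₂)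
... | false | true  = b , n , <⇒≤ b<n , ≤-refl ,
                      separated (cong₂ _xor_ b-splits₁ top₁) , separated (cong₂ _xor_ b-splits₂ top₂)
... | false | false = a , b , <⇒≤ a<n , <⇒≤ b<n ,
                      separated (cong₂ _xor_ a-splits₁ b-splits₁) , separated (cong₂ _xor_ a-splits₂ b-splits₂)

next-view : ∀ {n} (i : Fin (suc n)) →
            toℕ (next i) ≡ suc (toℕ i) ⊎ (toℕ i ≡ n × next i ≡ zero)
next-view {zero}  zero    = inj₂ (refl , refl)
next-view {suc n} zero    = inj₁ refl
next-view {suc n} (suc i) with next {n} i | next-view {n} i
... | zero  | inj₁ ()
... | zero  | inj₂ (i-last , _) = inj₂ (cong suc i-last , refl)
... | suc j | inj₁ next≡       = inj₁ (cong suc next≡)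
... | suc j | inj₂ (_ , ())

next-inject₁ : ∀ {n} (i : Fin (suc n)) → next (inject₁ i) ≡ suc i
next-inject₁ {zero}  zero    = refl
next-inject₁ {suc n} zero    = refl
next-inject₁ {suc n} (suc i) rewrite next-inject₁ i = refl

twoCut-next : ∀ {n e₁ e₂} (i : Fin (suc n)) → e₁ ≤ n → e₂ ≤ n →
              toℕ i ≢ e₁ → toℕ i ≢ e₂ → twoCut e₁ e₂ (toℕ i) ≡ twoCut e₁ e₂ (toℕ (next i))
twoCut-next i e₁≤n e₂≤n i≢e₁ i≢e₂ with next-view i
... | inj₁ next≡ rewrite next≡ = twoCut-step i≢e₁ i≢e₂
... | inj₂ (i≡n , next≡zero) rewrite next≡zero = trans (cong (twoCut _ _) i≡n) (
  twoCut-wrap (≤∧≢⇒< e₁≤n (λ e₁≡n → i≢e₁ (trans i≡n (sym e₁≡n))))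
              (≤∧≢⇒< e₂≤n (λ e₂≡n → i≢e₂ (trans i≡n (sym e₂≡n)))))

∈-tail : ∀ {A : Set} {x y : A} {xs} → x ∈ˡ y ∷ xs → x ≢ y → x ∈ˡ xs
∈-tail (here x≡y) x≢y = ⊥-elim (x≢y x≡y)
∈-tail (there x∈) _   = x∈

all-⊎? : ∀ {a b} {P : Fin a ⊎ Fin b → Set} → Decidable P → Dec (∀ x → P x)
all-⊎? P? with all? (λ i → P? (inj₁ i)) | all? (λ j → P? (inj₂ j))
... | yes on₁ | yes on₂ = yes λ { (inj₁ i) → on₁ i ; (inj₂ j) → on₂ j }
... | no ¬on₁ | _       = no λ on-all → ¬on₁ (λ i → on-all (inj₁ i))
... | _       | no ¬on₂ = no λ on-all → ¬on₂ (λ j → on-all (inj₂ j))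

any-⊎? : ∀ {a b} {P : Fin a ⊎ Fin b → Set} → Decidable P → Dec (∃ P)
any-⊎? P? with any? (λ i → P? (inj₁ i)) | any? (λ j → P? (inj₂ j))
... | yes (i , p) | _           = yes (inj₁ i , p)
... | no _        | yes (j , p) = yes (inj₂ j , p)
... | no ¬in₁     | no ¬in₂     = no λ { (inj₁ i , p) → ¬in₁ (i , p) ; (inj₂ j , p) → ¬in₂ (j , p) }

bbTail bbHead : ∀ κ k → Fin (bbEdges κ k) → Fin (bbVerts κ k)
bbTail path   k i = inject₁ i
bbTail cyclic k i = i
bbHead path   k i = suc i
bbHead cyclic k i = next i

bbEnds-backbone : ∀ κ k l i → bbEnds κ k l i ≡ (inj₁ (bbTail κ k i) , inj₁ (bbHead κ k i))
bbEnds-backbone path   k l i = refl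
bbEnds-backbone cyclic k l i = refl

module Caterpillar (κ : Kind) (k l : ℕ) (att : Fin l → Fin (bbVerts κ k)) where

  G : Graph
  G = Cat κ k l att

  nE : ℕ
  nE = bbEdges κ k

  bb : Fin nE → Fin (m G)
  bb i = i ↑ˡ l

  pe : Fin l → Fin (m G)
  pe j = nE ↑ʳ j

  ends-bb : ∀ i → ends G (bb i) ≡ (inj₁ (bbTail κ k i) , inj₁ (bbHead κ k i))
  ends-bb i rewrite splitAt-↑ˡ nE i l = bbEnds-backbone κ k l i

  ends-pe : ∀ j → ends G (pe j) ≡ (inj₁ (att j) , inj₂ j)
  ends-pe j rewrite splitAt-↑ʳ nE l j = refl

  edge-cases : ∀ e → (∃[ i ] e ≡ bb i) ⊎ (∃[ j ] e ≡ pe j)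
  edge-cases e with splitAt nE e in split≡
  ... | inj₁ i = inj₁ (i , sym (splitAt⁻¹-↑ˡ split≡))
  ... | inj₂ j = inj₂ (j , sym (splitAt⁻¹-↑ʳ split≡))

  pe≢bb : ∀ {j i} → pe j ≢ bb i
  pe≢bb {j} {i} pe≡bb
    with trans (sym (splitAt-↑ʳ nE l j)) (trans (cong (splitAt nE) pe≡bb) (splitAt-↑ˡ nE i l))
  ... | ()

  pe-injective : ∀ {j j′} → pe j ≡ pe j′ → j ≡ j′
  pe-injective {j} {j′} pe≡pe
    with trans (sym (splitAt-↑ʳ nE l j)) (trans (cong (splitAt nE) pe≡pe) (splitAt-↑ʳ nE l j′))
  ... | refl = refl

  pos : CatV κ k l → Fin (bbVerts κ k)
  pos (inj₁ i) = i
  pos (inj₂ j) = att j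

  leaf-edge : ∀ {e x j} → ends G e ≡ (x , inj₂ j) ⊎ ends G e ≡ (inj₂ j , x) → e ≡ pe j
  leaf-edge {e} at-leaf with edge-cases e
  leaf-edge (inj₁ at-leaf) | inj₁ (i , refl) with trans (sym (ends-bb i)) at-leaf
  ... | ()
  leaf-edge (inj₂ at-leaf) | inj₁ (i , refl) with trans (sym (ends-bb i)) at-leaf
  ... | ()
  leaf-edge (inj₁ at-leaf) | inj₂ (j′ , refl) with trans (sym (ends-pe j′)) at-leaf
  ... | refl = refl
  leaf-edge (inj₂ at-leaf) | inj₂ (j′ , refl) with trans (sym (ends-pe j′)) at-leaf
  ... | ()

  module _ {S : EdgeSet G} where

    leaf-adj-uncut : ∀ {x j} → Adj G S x (inj₂ j) → pe j ∉ S
    leaf-adj-uncut (e , e∉S , at-leaf) = subst (_∉ S) (leaf-edge at-leaf) e∉S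

    cut-leaf-isolated : ∀ {x j} → pe j ∈ S → Reach G S x (inj₂ j) → x ≡ inj₂ j
    cut-leaf-isolated pe∈S here = refl
    cut-leaf-isolated pe∈S (step xv p) with cut-leaf-isolated pe∈S p
    ... | refl = ⊥-elim (leaf-adj-uncut xv pe∈S)

    cut-or-attached : ∀ z → (∃[ j ] (z ≡ inj₂ j × pe j ∈ S)) ⊎ Reach G S (inj₁ (pos z)) z
    cut-or-attached (inj₁ i) = inj₂ here
    cut-or-attached (inj₂ j) with pe j ∈? S
    ... | yes pe∈S = inj₁ (j , refl , pe∈S)
    ... | no  pe∉S = inj₂ (step (pe j , pe∉S , inj₁ (ends-pe j)) here)

    uncut-≢ : ∀ {i i′} → bb i ∉ S → bb i′ ∈ S → toℕ i ≢ toℕ i′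
    uncut-≢ bb∉S bb′∈S i≡i′ = bb∉S (subst (λ i″ → bb i″ ∈ S) (sym (toℕ-injective i≡i′)) bb′∈S)

    uncut-index : ∀ {i e} (e<nE : e < nE) → bb i ∉ S → bb (fromℕ< e<nE) ∈ S → toℕ i ≢ e
    uncut-index e<nE bb∉S cut∈S = subst (_ ≢_) (toℕ-fromℕ< e<nE) (uncut-≢ bb∉S cut∈S)

  vertex≟ : DecidableEquality (CatV κ k l)
  vertex≟ = ≡-dec _≟ᶠ_ _≟ᶠ_

  open DecidableReach G vertex≟ public using (reach?)

  cutSide : ℕ → ℕ → Fin (bbVerts κ k) → Bool
  cutSide e₁ e₂ p = twoCut e₁ e₂ (toℕ p)

  module Colouring (c : CatV κ k l → ℕ) (stars : ColourfulStars κ k l att c) where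

    colourful? : Decidable (Colourful G c)
    colourful? S = all-⊎? λ u → all-⊎? λ v → reach? S u v →-dec ((c u ≟ c v) →-dec vertex≟ u v)

    Conflict : EdgeSet G → Fin l → Set
    Conflict S j = ∃[ t ] (Reach G S (inj₁ (att j)) t × c t ≡ c (inj₂ j))

    conflict? : ∀ S j → Dec (Conflict S j)
    conflict? S j = any-⊎? λ t → reach? S (inj₁ (att j)) t ×-dec (c t ≟ c (inj₂ j))

    SafeFor : EdgeSet G → Fin l → (Fin (bbVerts κ k) → Bool) → Set
    SafeFor S j σ = ∀ t → Reach G S (inj₁ (att j)) t → c t ≡ c (inj₂ j) → σ (pos t) ≢ σ (att j)

    record Demand (S : EdgeSet G) (j : Fin l) : Set where
      field
        x y      : Fin (bbVerts κ k)
        distinct : x ≢ y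
        suffices : ∀ σ → σ x ≢ σ y → SafeFor S j σ

    unconflicted-demand : ∀ {S j} → ¬ Conflict S j → ∀ {x y} → x ≢ y → Demand S j
    unconflicted-demand no-conflict {x} {y} x≢y = record
      { x = x ; y = y ; distinct = x≢y
      ; suffices = λ _ _ t att↝t same → ⊥-elim (no-conflict (t , att↝t , same)) }

    conflict-elsewhere : ∀ {S j t} → pe j ∈ S → Reach G S (inj₁ (att j)) t →
                         c t ≡ c (inj₂ j) → pos t ≢ att j
    conflict-elsewhere {t = inj₁ i}  _    _    same refl = proj₁ stars _ same
    conflict-elsewhere {t = inj₂ j′} pe∈S att↝t same att≡ with proj₂ stars j′ _ att≡ same
    ... | refl with cut-leaf-isolated pe∈S att↝t
    ...   | ()

    -- In a colourful G − S the conflict is unique, so it only has to be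
    -- separated from att j.
    conflict-demand : ∀ {S j} → Colourful G c S → pe j ∈ S → Conflict S j → Demand S j
    conflict-demand {S} {j} colourful pe∈S (t , att↝t , same) = record
      { x = pos t ; y = att j ; distinct = conflict-elsewhere pe∈S att↝t same
      ; suffices = λ σ differ t′ att↝t′ same′ →
          subst (λ u → σ (pos u) ≢ σ (att j))
                (colourful t t′ (reach-trans (reach-sym att↝t) att↝t′) (trans same (sym same′)))
                differ }

    record Exchange (S : EdgeSet G) (j : Fin l) : Set where
      field
        S′             : EdgeSet G
        colourful      : Colourful G c S′
        no-larger      : ∣ S′ ∣ ≤ ∣ S ∣
        reattaches-j        : pe j ∉ S′
        no-new-pendant : ∀ j′ → pe j′ ∈ S′ → pe j′ ∈ S

    record Swap (S : EdgeSet G) (j : Fin l) : Set where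
      field
        freed cut      : EdgeSet G
        freed⊆S        : freed ⊆ S
        fewer-cuts     : ∣ cut ∣ ≤ ∣ freed ∣
        freed-pendant  : ∀ {e} → e ∈ freed → ∃[ j′ ] e ≡ pe j′
        cut-backbone   : ∀ {e} → e ∈ cut → ∃[ i ] e ≡ bb i
        frees-j        : pe j ∈ freed
        freed-distinct : ∀ {j₁ j₂} → pe j₁ ∈ freed → pe j₂ ∈ freed →
                         c (inj₂ j₁) ≡ c (inj₂ j₂) → j₁ ≡ j₂
        side           : Fin (bbVerts κ k) → Bool
        side-constant  : ∀ i → bb i ∉ (S ─ freed) ∪ cut →
                         side (bbTail κ k i) ≡ side (bbHead κ k i)
        freed-safe     : ∀ {j′} → pe j′ ∈ freed → SafeFor S j′ side

    -- Colourfulness is the heart of the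
    -- proof: collapse every freed leaf onto its attachment; a walk in
    -- G − S′ then projects to a walk in G − S, and the side function is
    -- constant along it.  Two vertices of one colour in a component of
    -- G − S′ are then equal: if one is a freed leaf j, the other is a
    -- same-coloured vertex reachable from att j on the same side,
    -- contradicting safety; otherwise colourfulness of G − S applies.
    module SwapResult {S j} (S-colourful : Colourful G c S) (swap : Swap S j) where
      open Swap swap

      S′ : EdgeSet G
      S′ = (S ─ freed) ∪ cut

      freed-uncut : ∀ {j′} → pe j′ ∈ freed → pe j′ ∉ S′
      freed-uncut pe∈freed pe∈S′ with x∈p∪q⁻ (S ─ freed) cut pe∈S′
      ... | inj₁ pe∈S─freed = ∈q⇒∉p─q pe∈freed pe∈S─freed
      ... | inj₂ pe∈cut     = pe≢bb (proj₂ (cut-backbone pe∈cut))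

      only-freed : ∀ {e} → e ∉ S′ → e ∉ S ⊎ ∃[ j′ ] (pe j′ ∈ freed × e ≡ pe j′)
      only-freed {e} e∉S′ with e ∈? freed
      ... | yes e∈freed = let (j′ , e≡pe) = freed-pendant e∈freed
                          in inj₂ (j′ , subst (_∈ freed) e≡pe e∈freed , e≡pe)
      ... | no  e∉freed = inj₁ λ e∈S → e∉S′ (p⊆p∪q cut (x∈p∧x∉q⇒x∈p─q e∈S e∉freed))

      no-new-pendant : ∀ j′ → pe j′ ∈ S′ → pe j′ ∈ S
      no-new-pendant j′ pe∈S′ with x∈p∪q⁻ (S ─ freed) cut pe∈S′
      ... | inj₁ pe∈S─freed = p─q⊆p S freed pe∈S─freed
      ... | inj₂ pe∈cut     = ⊥-elim (pe≢bb (proj₂ (cut-backbone pe∈cut)))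

      collapse : CatV κ k l → CatV κ k l
      collapse (inj₁ i) = inj₁ i
      collapse (inj₂ j′) with pe j′ ∈? freed
      ... | yes _ = inj₁ (att j′)
      ... | no  _ = inj₂ j′

      data Collapsed : CatV κ k l → Set where
        freed-leaf : ∀ {j′} → pe j′ ∈ freed → Collapsed (inj₂ j′)
        fixed      : ∀ {x} → collapse x ≡ x → Collapsed x

      collapse-freed : ∀ {j′} → pe j′ ∈ freed → collapse (inj₂ j′) ≡ inj₁ (att j′)
      collapse-freed {j′} pe∈freed with pe j′ ∈? freed
      ... | yes _        = refl
      ... | no  pe∉freed = ⊥-elim (pe∉freed pe∈freed)

      collapse-unfreed : ∀ {j′} → pe j′ ∉ freed → collapse (inj₂ j′) ≡ inj₂ j′
      collapse-unfreed {j′} pe∉freed with pe j′ ∈? freed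
      ... | yes pe∈freed = ⊥-elim (pe∉freed pe∈freed)
      ... | no  _        = refl

      collapsed : ∀ x → Collapsed x
      collapsed (inj₁ i) = fixed refl
      collapsed (inj₂ j′) with pe j′ ∈? freed
      ... | yes pe∈freed = freed-leaf pe∈freed
      ... | no  pe∉freed = fixed (collapse-unfreed pe∉freed)

      -- freed leaves are isolated in G − S, so edges of G − S avoid them
      collapse-uncut : ∀ {x v} → Adj G S x v → collapse x ≡ x
      collapse-uncut {inj₁ i}  _  = refl
      collapse-uncut {inj₂ j′} xv with pe j′ ∈? freed
      ... | yes pe∈freed = ⊥-elim (leaf-adj-uncut (adj-sym xv) (freed⊆S pe∈freed))
      ... | no  _        = refl

      collapse-pendant : ∀ {j′ x v} → pe j′ ∈ freed → ends G (pe j′) ≡ (x , v) → collapse x ≡ collapse v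
      collapse-pendant {j′} pe∈freed ends≡ with trans (sym (ends-pe j′)) ends≡
      ... | refl = sym (collapse-freed pe∈freed)

      project-adj : ∀ {x v} → Adj G S′ x v → Reach G S (collapse x) (collapse v)
      project-adj {x} {v} (e , e∉S′ , joins) with only-freed e∉S′
      ... | inj₁ e∉S =
        subst₂ (Reach G S) (sym (collapse-uncut xv)) (sym (collapse-uncut (adj-sym xv))) (step xv here)
        where
        xv : Adj G S x v
        xv = e , e∉S , joins
      ... | inj₂ (j′ , pe∈freed , refl) with joins
      ...   | inj₁ xv≡ = subst (Reach G S _) (collapse-pendant pe∈freed xv≡) here
      ...   | inj₂ vx≡ = subst (Reach G S _) (sym (collapse-pendant pe∈freed vx≡)) here

      project : ∀ {x y} → Reach G S′ x y → Reach G S (collapse x) (collapse y)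
      project here        = here
      project (step xv p) = reach-trans (project-adj xv) (project p)

      side-edge : ∀ {e x v} → e ∉ S′ → ends G e ≡ (x , v) → side (pos x) ≡ side (pos v)
      side-edge {e} e∉S′ ends≡ with edge-cases e
      ... | inj₁ (i , refl) with trans (sym (ends-bb i)) ends≡
      ...   | refl = side-constant i e∉S′
      side-edge e∉S′ ends≡ | inj₂ (j′ , refl) with trans (sym (ends-pe j′)) ends≡
      ...   | refl = refl

      side-along : ∀ {x y} → Reach G S′ x y → side (pos x) ≡ side (pos y)
      side-along here = refl
      side-along (step (e , e∉S′ , inj₁ ends≡) p) = trans (side-edge e∉S′ ends≡) (side-along p)
      side-along (step (e , e∉S′ , inj₂ ends≡) p) = trans (sym (side-edge e∉S′ ends≡)) (side-along p)

      freed-alone : ∀ {j′ y} → pe j′ ∈ freed → collapse y ≡ y →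
                    Reach G S′ (inj₂ j′) y → c (inj₂ j′) ≢ c y
      freed-alone pe∈freed y-fixed j′↝y same =
        freed-safe pe∈freed _ (subst₂ (Reach G S) (collapse-freed pe∈freed) y-fixed (project j′↝y))
                   (sym same) (sym (side-along j′↝y))

      S′-colourful : Colourful G c S′
      S′-colourful x y x↝y same with collapsed x | collapsed y
      ... | freed-leaf x-freed | freed-leaf y-freed = cong inj₂ (freed-distinct x-freed y-freed same)
      ... | freed-leaf x-freed | fixed y-fixed = ⊥-elim (freed-alone x-freed y-fixed x↝y same)
      ... | fixed x-fixed | freed-leaf y-freed = ⊥-elim (freed-alone y-freed x-fixed (reach-sym x↝y) (sym same))
      ... | fixed x-fixed | fixed y-fixed =
        S-colourful x y (subst₂ (Reach G S) x-fixed y-fixed (project x↝y)) same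

      exchange : Exchange S j
      exchange = record
        { S′             = S′
        ; colourful      = S′-colourful
        ; no-larger      = ∣replace∣≤ S freed cut freed⊆S fewer-cuts
        ; reattaches-j        = freed-uncut frees-j
        ; no-new-pendant = no-new-pendant
        }

    swap-exchange : ∀ {S j} → Colourful G c S → Swap S j → Exchange S j
    swap-exchange = SwapResult.exchange

    single-swap : ∀ {S j} → pe j ∈ S → (cut : EdgeSet G) → ∣ cut ∣ ≤ 1 →
                  (∀ {e} → e ∈ cut → ∃[ i ] e ≡ bb i) → (σ : Fin (bbVerts κ k) → Bool) →
                  (∀ i → bb i ∉ (S ─ ⁅ pe j ⁆) ∪ cut → σ (bbTail κ k i) ≡ σ (bbHead κ k i)) →
                  SafeFor S j σ → Swap S j
    single-swap {S} {j} pe∈S cut ∣cut∣≤1 cut-backbone σ σ-constant safe = record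
      { freed          = ⁅ pe j ⁆
      ; cut            = cut
      ; freed⊆S        = ⁅⁆-⊆ pe∈S
      ; fewer-cuts     = ≤-trans ∣cut∣≤1 (≤-reflexive (sym (∣⁅x⁆∣≡1 (pe j))))
      ; freed-pendant  = λ e∈ → j , x∈⁅y⁆⇒x≡y _ e∈
      ; cut-backbone   = cut-backbone
      ; frees-j        = x∈⁅x⁆ (pe j)
      ; freed-distinct = λ pe₁∈ pe₂∈ _ → trans (only-j pe₁∈) (sym (only-j pe₂∈))
      ; side           = σ
      ; side-constant  = σ-constant
      ; freed-safe     = λ pe∈ → subst (λ j′ → SafeFor S j′ σ) (sym (only-j pe∈)) safe
      }
      where
      only-j : ∀ {j′} → pe j′ ∈ ⁅ pe j ⁆ → j′ ≡ j
      only-j pe∈ = pe-injective (x∈⁅y⁆⇒x≡y _ pe∈)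

    free-leaf : ∀ {S j} → pe j ∈ S → ¬ Conflict S j → Swap S j
    free-leaf pe∈S no-conflict =
      single-swap pe∈S ∅ (≤-trans (≤-reflexive (∣⊥∣≡0 (m G))) z≤n) (λ e∈∅ → ⊥-elim (∉⊥ e∈∅))
                  (λ _ → true) (λ _ _ → refl) (λ t att↝t same _ → no-conflict (t , att↝t , same))

    one-cut-swap : ∀ {S j} → pe j ∈ S → (i : Fin nE) → (σ : Fin (bbVerts κ k) → Bool) →
                   (∀ i′ → bb i′ ∉ (S ─ ⁅ pe j ⁆) ∪ ⁅ bb i ⁆ → σ (bbTail κ k i′) ≡ σ (bbHead κ k i′)) →
                   SafeFor S j σ → Swap S j
    one-cut-swap pe∈S i = single-swap pe∈S ⁅ bb i ⁆ (≤-reflexive (∣⁅x⁆∣≡1 (bb i)))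
                                      (λ e∈ → i , x∈⁅y⁆⇒x≡y _ e∈)

    pair-swap : ∀ {S j j₂} → pe j ∈ S → pe j₂ ∈ S → c (inj₂ j) ≢ c (inj₂ j₂) →
                (i₁ i₂ : Fin nE) → (σ : Fin (bbVerts κ k) → Bool) →
                (∀ i → bb i ∉ (S ─ (⁅ pe j ⁆ ∪ ⁅ pe j₂ ⁆)) ∪ (⁅ bb i₁ ⁆ ∪ ⁅ bb i₂ ⁆) →
                       σ (bbTail κ k i) ≡ σ (bbHead κ k i)) →
                SafeFor S j σ → SafeFor S j₂ σ → Swap S j
    pair-swap {S} {j} {j₂} pe∈S pe₂∈S colours-differ i₁ i₂ σ σ-constant safe₁ safe₂ = record
      { freed          = ⁅ pe j ⁆ ∪ ⁅ pe j₂ ⁆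
      ; cut            = ⁅ bb i₁ ⁆ ∪ ⁅ bb i₂ ⁆
      ; freed⊆S        = pair-⊆ pe∈S pe₂∈S
      ; fewer-cuts     = ≤-trans (∣pair∣≤2 (bb i₁) (bb i₂))
                                 (2≤∣pair∣ (λ pe≡pe₂ → colours-differ (cong (c ∘ inj₂) (pe-injective pe≡pe₂))))
      ; freed-pendant  = pendant
      ; cut-backbone   = backbone
      ; frees-j        = p⊆p∪q ⁅ pe j₂ ⁆ (x∈⁅x⁆ (pe j))
      ; freed-distinct = distinct
      ; side           = σ
      ; side-constant  = σ-constant
      ; freed-safe     = safe
      }
      where
      freed-leaves : ∀ {j′} → pe j′ ∈ ⁅ pe j ⁆ ∪ ⁅ pe j₂ ⁆ → j′ ≡ j ⊎ j′ ≡ j₂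
      freed-leaves pe∈ = map-⊎ pe-injective pe-injective (∈-pair⁻ pe∈)

      pendant : ∀ {e} → e ∈ ⁅ pe j ⁆ ∪ ⁅ pe j₂ ⁆ → ∃[ j′ ] e ≡ pe j′
      pendant e∈ with ∈-pair⁻ e∈
      ... | inj₁ e≡ = j  , e≡
      ... | inj₂ e≡ = j₂ , e≡

      backbone : ∀ {e} → e ∈ ⁅ bb i₁ ⁆ ∪ ⁅ bb i₂ ⁆ → ∃[ i ] e ≡ bb i
      backbone e∈ with ∈-pair⁻ e∈
      ... | inj₁ e≡ = i₁ , e≡
      ... | inj₂ e≡ = i₂ , e≡

      distinct : ∀ {j′ j″} → pe j′ ∈ ⁅ pe j ⁆ ∪ ⁅ pe j₂ ⁆ → pe j″ ∈ ⁅ pe j ⁆ ∪ ⁅ pe j₂ ⁆ →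
                 c (inj₂ j′) ≡ c (inj₂ j″) → j′ ≡ j″
      distinct pe′∈ pe″∈ same with freed-leaves pe′∈ | freed-leaves pe″∈
      ... | inj₁ refl | inj₁ refl = refl
      ... | inj₂ refl | inj₂ refl = refl
      ... | inj₁ refl | inj₂ refl = ⊥-elim (colours-differ same)
      ... | inj₂ refl | inj₁ refl = ⊥-elim (colours-differ (sym same))

      safe : ∀ {j′} → pe j′ ∈ ⁅ pe j ⁆ ∪ ⁅ pe j₂ ⁆ → SafeFor S j′ σ
      safe pe∈ with freed-leaves pe∈
      ... | inj₁ refl = safe₁
      ... | inj₂ refl = safe₂

    clear-pendants : (∀ {S j} → Colourful G c S → pe j ∈ S → Exchange S j) →
                     ∀ (js : List (Fin l)) {S} → Colourful G c S → (∀ j → pe j ∈ S → j ∈ˡ js) →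
                     ∃[ S′ ] (Colourful G c S′ × InBackbone κ k l att S′ × ∣ S′ ∣ ≤ ∣ S ∣)
    clear-pendants exchange []       {S} colourful among =
      S , colourful , (λ j pe∈S → ¬Any[] (among j pe∈S)) , ≤-refl
    clear-pendants exchange (j ∷ js) {S} colourful among with pe j ∈? S
    ... | no pe∉S = clear-pendants exchange js colourful
                      (λ j′ pe′∈S → ∈-tail (among j′ pe′∈S) (λ { refl → pe∉S pe′∈S }))
    ... | yes pe∈S =
      let open Exchange (exchange colourful pe∈S) renaming (colourful to colourful′)
          (S″ , colourful″ , in-backbone , S″≤S′) =
            clear-pendants exchange js colourful′
              (λ j′ pe′∈S′ → ∈-tail (among j′ (no-new-pendant j′ pe′∈S′)) (λ { refl → reattaches-j pe′∈S′ }))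
      in S″ , colourful″ , in-backbone , ≤-trans S″≤S′ no-larger

-- Paths: cut the backbone edge just after the lower of the positions of
-- the conflict and of att j.

module PathCaterpillar (k l : ℕ) (att : Fin l → Fin (suc k))
                       (c : CatV path k l → ℕ) (stars : ColourfulStars path k l att c) where
  open Caterpillar path k l att
  open Colouring c stars

  -- a conflict of j is separated from att j by one cut; the side of the
  -- inert top cut k is the same everywhere
  path-swap : ∀ {S j} → Colourful G c S → pe j ∈ S → Conflict S j → Swap S j
  path-swap {S} {j} colourful pe∈S conflict =
    choose (path-cut (λ x≡y → distinct (toℕ-injective x≡y)) (toℕ≤pred[n] x) (toℕ≤pred[n] y))
    where
    open Demand (conflict-demand colourful pe∈S conflict)

    choose : ∃[ e ] (e < k × Separates e k (toℕ x) (toℕ y)) → Swap S j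
    choose (e , e<k , separates) =
      one-cut-swap pe∈S cut (cutSide e k) constant (suffices (cutSide e k) (separates⇒sides-differ separates))
      where
      cut : Fin k
      cut = fromℕ< e<k

      constant : ∀ i → bb i ∉ (S ─ ⁅ pe j ⁆) ∪ ⁅ bb cut ⁆ → cutSide e k (inject₁ i) ≡ cutSide e k (suc i)
      constant i bb∉ rewrite toℕ-inject₁ i =
        twoCut-step (uncut-index e<k bb∉ (q⊆p∪q (S ─ ⁅ pe j ⁆) ⁅ bb cut ⁆ (x∈⁅x⁆ (bb cut))))
                    (<⇒≢ (toℕ<n i))

  swap-at : ∀ {S j} → Colourful G c S → pe j ∈ S → Swap S j
  swap-at {S} {j} colourful pe∈S with conflict? S j
  ... | no  no-conflict = free-leaf pe∈S no-conflict
  ... | yes conflict    = path-swap colourful pe∈S conflict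

-- Cycles: one cut only splits the backbone into a path, so separating
-- a conflict needs two cuts.  If S already cuts the backbone, one new cut
-- suffices; otherwise a second cut leaf of another colour exists and is
-- freed as well, paying for the second cut.

module CyclicCaterpillar (k l : ℕ) (att : Fin l → Fin (suc (suc (suc k))))
                         (c : CatV cyclic k l → ℕ) (stars : ColourfulStars cyclic k l att c) where
  open Caterpillar cyclic k l att
  open Colouring c stars

  -- the last backbone position, which is also the index of the last edge
  K : ℕ
  K = suc (suc k)

  cycle-side-constant : ∀ {S′ e₁ e₂} → e₁ ≤ K → e₂ ≤ K →
                        (∀ {i} → bb i ∉ S′ → toℕ i ≢ e₁ × toℕ i ≢ e₂) →
                        ∀ i → bb i ∉ S′ → cutSide e₁ e₂ i ≡ cutSide e₁ e₂ (next i)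
  cycle-side-constant e₁≤K e₂≤K avoids i bb∉ =
    twoCut-next i e₁≤K e₂≤K (proj₁ (avoids bb∉)) (proj₂ (avoids bb∉))

  one-more-cut : ∀ {S j b₀} → Colourful G c S → pe j ∈ S → bb b₀ ∈ S → Conflict S j → Swap S j
  one-more-cut {S} {j} {b₀} colourful pe∈S b₀∈S conflict =
    choose (second-cut (toℕ b₀) (λ x≡y → distinct (toℕ-injective x≡y)) (toℕ≤pred[n] x) (toℕ≤pred[n] y))
    where
    open Demand (conflict-demand colourful pe∈S conflict)

    choose : ∃[ e ] (e ≤ K × Separates (toℕ b₀) e (toℕ x) (toℕ y)) → Swap S j
    choose (e , e≤K , separates) =
      one-cut-swap pe∈S cut (cutSide (toℕ b₀) e)
        (cycle-side-constant (toℕ≤pred[n] b₀) e≤K avoids)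
        (suffices (cutSide (toℕ b₀) e) (separates⇒sides-differ separates))
      where
      cut : Fin (suc K)
      cut = fromℕ< (s≤s e≤K)

      b₀-kept : bb b₀ ∈ (S ─ ⁅ pe j ⁆) ∪ ⁅ bb cut ⁆
      b₀-kept = p⊆p∪q ⁅ bb cut ⁆ (x∈p∧x∉q⇒x∈p─q b₀∈S (λ b₀∈⁅pe⁆ → pe≢bb (sym (x∈⁅y⁆⇒x≡y _ b₀∈⁅pe⁆))))

      avoids : ∀ {i} → bb i ∉ (S ─ ⁅ pe j ⁆) ∪ ⁅ bb cut ⁆ → toℕ i ≢ toℕ b₀ × toℕ i ≢ e
      avoids bb∉ = uncut-≢ bb∉ b₀-kept , uncut-index (s≤s e≤K) bb∉ (q⊆p∪q _ _ (x∈⁅x⁆ (bb cut)))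

  module _ {S : EdgeSet G} (no-backbone-cut : ∀ i → bb i ∉ S) where

    backbone-connected : ∀ i → Reach G S (inj₁ zero) (inj₁ i)
    backbone-connected = <-weakInduction (λ i → Reach G S (inj₁ zero) (inj₁ i)) here
      λ i zero↝i → reach-trans zero↝i (step (bb (inject₁ i) , no-backbone-cut (inject₁ i) , inj₁ (edge i)) here)
      where
      edge : ∀ i → ends G (bb (inject₁ i)) ≡ (inj₁ (inject₁ i) , inj₁ (suc i))
      edge i = trans (ends-bb (inject₁ i)) (cong (λ h → inj₁ (inject₁ i) , inj₁ h) (next-inject₁ i))

    -- vertices that are not cut leaves are all connected, so a colour
    -- repeated in a colourful G − S appears on a cut leaf
    repeated-on-cut-leaf : Colourful G c S → ∀ {u v} → u ≢ v → c u ≡ c v →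
                           ∃[ j ] (pe j ∈ S × c (inj₂ j) ≡ c u)
    repeated-on-cut-leaf colourful {u} {v} u≢v same with cut-or-attached u | cut-or-attached v
    ... | inj₁ (j , refl , pe∈S) | _                      = j , pe∈S , refl
    ... | inj₂ _                 | inj₁ (j , refl , pe∈S) = j , pe∈S , sym same
    ... | inj₂ u-attached        | inj₂ v-attached        = ⊥-elim (u≢v (colourful u v u↝v same))
      where
      u↝v : Reach G S u v
      u↝v = reach-trans (reach-sym u-attached)
              (reach-trans (reach-sym (backbone-connected (pos u)))
                (reach-trans (backbone-connected (pos v)) v-attached))

    other-cut-leaf : Colourful G c S → TwoRepeatedColours c → ∀ j →
                     ∃[ j₂ ] (pe j₂ ∈ S × c (inj₂ j) ≢ c (inj₂ j₂))
    other-cut-leaf colourful (a , b , a≢b , (u₁ , v₁ , u₁≢v₁ , u₁-a , v₁-a) , (u₂ , v₂ , u₂≢v₂ , u₂-b , v₂-b)) j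
      with repeated-on-cut-leaf colourful u₁≢v₁ (trans u₁-a (sym v₁-a))
         | repeated-on-cut-leaf colourful u₂≢v₂ (trans u₂-b (sym v₂-b))
         | c (inj₂ j) ≟ a
    ... | _ , _ , _ | jb , pb∈S , jb-b | yes j-a =
      jb , pb∈S , λ same → a≢b (trans (sym j-a) (trans same (trans jb-b u₂-b)))
    ... | ja , pa∈S , ja-a | _ | no j-not-a =
      ja , pa∈S , λ same → j-not-a (trans same (trans ja-a u₁-a))

  two-new-cuts : ∀ {S j j₂} → Colourful G c S → pe j ∈ S → pe j₂ ∈ S →
                 c (inj₂ j) ≢ c (inj₂ j₂) → Conflict S j → Swap S j
  two-new-cuts {S} {j} {j₂} colourful pe∈S pe₂∈S colours-differ conflict =
    choose (two-cuts (λ x≡y → D₁.distinct (toℕ-injective x≡y)) (toℕ≤pred[n] D₁.x) (toℕ≤pred[n] D₁.y)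
                     (λ x≡y → D₂.distinct (toℕ-injective x≡y)) (toℕ≤pred[n] D₂.x) (toℕ≤pred[n] D₂.y))
    where
    -- without a conflict, j₂ imposes no real constraint: any pair will do
    demand₂ : Demand S j₂
    demand₂ with conflict? S j₂
    ... | yes conflict₂   = conflict-demand colourful pe₂∈S conflict₂
    ... | no no-conflict₂ = unconflicted-demand no-conflict₂ {zero} {suc zero} (λ ())

    module D₁ = Demand (conflict-demand colourful pe∈S conflict)
    module D₂ = Demand demand₂

    choose : ∃[ e₁ ] ∃[ e₂ ] (e₁ ≤ K × e₂ ≤ K × Separates e₁ e₂ (toℕ D₁.x) (toℕ D₁.y)
                                             × Separates e₁ e₂ (toℕ D₂.x) (toℕ D₂.y)) → Swap S j
    choose (e₁ , e₂ , e₁≤K , e₂≤K , separates₁ , separates₂) =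
      pair-swap pe∈S pe₂∈S colours-differ cut₁ cut₂ (cutSide e₁ e₂)
        (cycle-side-constant e₁≤K e₂≤K avoids)
        (D₁.suffices (cutSide e₁ e₂) (separates⇒sides-differ separates₁))
        (D₂.suffices (cutSide e₁ e₂) (separates⇒sides-differ separates₂))
      where
      cut₁ cut₂ : Fin (suc K)
      cut₁ = fromℕ< (s≤s e₁≤K)
      cut₂ = fromℕ< (s≤s e₂≤K)

      S′ : EdgeSet G
      S′ = (S ─ (⁅ pe j ⁆ ∪ ⁅ pe j₂ ⁆)) ∪ (⁅ bb cut₁ ⁆ ∪ ⁅ bb cut₂ ⁆)

      avoids : ∀ {i} → bb i ∉ S′ → toℕ i ≢ e₁ × toℕ i ≢ e₂
      avoids bb∉ = uncut-index (s≤s e₁≤K) bb∉ (q⊆p∪q _ _ (p⊆p∪q ⁅ bb cut₂ ⁆ (x∈⁅x⁆ (bb cut₁))))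
                 , uncut-index (s≤s e₂≤K) bb∉ (q⊆p∪q _ _ (q⊆p∪q ⁅ bb cut₁ ⁆ ⁅ bb cut₂ ⁆ (x∈⁅x⁆ (bb cut₂))))

  swap-at : TwoRepeatedColours c → ∀ {S j} → Colourful G c S → pe j ∈ S → Swap S j
  swap-at repeated {S} {j} colourful pe∈S with conflict? S j
  ... | no  no-conflict = free-leaf pe∈S no-conflict
  ... | yes conflict with any? (λ i → bb i ∈? S)
  ...   | yes (b₀ , b₀∈S) = one-more-cut colourful pe∈S b₀∈S conflict
  ...   | no  no-cut with other-cut-leaf (λ i bb∈S → no-cut (i , bb∈S)) colourful repeated j
  ...     | j₂ , pe₂∈S , colours-differ = two-new-cuts colourful pe∈S pe₂∈S colours-differ conflict

-- Every cut pendant edge of a colourful solution admits an exchange.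
exchange-at : (κ : Kind) (k l : ℕ) (att : Fin l → Fin (bbVerts κ k)) (c : CatV κ k l → ℕ)
              (stars : ColourfulStars κ k l att c) → TwoRepeatedColours c →
              let open Caterpillar κ k l att
                  open Colouring c stars
              in ∀ {S j} → Colourful G c S → pe j ∈ S → Exchange S j
exchange-at path k l att c stars _ colourful pe∈S =
  swap-exchange colourful (swap-at colourful pe∈S)
  where
  open Caterpillar path k l att
  open Colouring c stars
  open PathCaterpillar k l att c stars
exchange-at cyclic k l att c stars repeated colourful pe∈S =
  swap-exchange colourful (swap-at repeated colourful pe∈S)
  where
  open Caterpillar cyclic k l att
  open Colouring c stars
  open CyclicCaterpillar k l att c stars

all-cut-colourful : (G : Graph) (c : V G → ℕ) → Colourful G c ⊤
all-cut-colourful G c u .u here _ = refl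
all-cut-colourful G c u v (step (e , e∉⊤ , _) _) _ = ⊥-elim (e∉⊤ ∈⊤)

-- Take an optimal solution S₀ (a minimum among the colourful edge sets,
-- which exist since ⊤ is one) and clear its pendant cuts by exchanges;
-- the result is colourful, no larger than S₀, hence optimal, and uses
-- backbone edges only.
mainTheorem3 : (κ : Kind) (k l : ℕ) (att : Fin l → Fin (bbVerts κ k))
               (c : CatV κ k l → ℕ) →
               ColourfulStars κ k l att c →
               TwoRepeatedColours c →
               ∃[ S ] (OptimalSolution (Cat κ k l att) c S × InBackbone κ k l att S)
mainTheorem3 κ k l att c stars repeated =
  let (S₀ , colourful₀ , minimum₀) = minimum-subset (Colourful G c) colourful? ⊤ (all-cut-colourful G c)
      (S , colourful , in-backbone , S≤S₀) =
        clear-pendants (exchange-at κ k l att c stars repeated) (allFin l) colourful₀ (λ j _ → ∈-allFin j)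
  in S , (colourful , λ S′ colourful′ → ≤-trans S≤S₀ (minimum₀ S′ colourful′)) , in-backbone
  where
  open Caterpillar κ k l att
  open Colouring c stars
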